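{- Let $G=(V,E)$ be a finite simple graph of order $n$, $T=n-1$, and let $k$ be an integer with $k\le\operatorname{PT}(G)$. Let $(x,y,z)$ be an optimal solution of the model minimizing $\sum_{v\in V}x^0_v+\frac{1}{2T}\sum_{t\in[T]}z^t$ over binary variables $x^t_v$ ($v\in V$, $t\in\{0,\ldots,T\}$), $y^t_a$ ($a\in A$, $t\in[T]$), $z^t$ ($t\in[T]$) subject to (1) $x^0_v+\sum_{t\in[T]}\sum_{a=(u,v)\in A}y^t_a=1$ for all $v$; (2) $y^t_a\le x^{t-1}_u$ for all $a=(u,v)\in A$, $t\in[T]$; (3) $y^t_a\le x^{t-1}_w$ for all $a=(u,v)\in A$, $w\in N(u)\setminus\{v\}$, $t\in[T]$; (4) $x^t_v=x^{t-1}_v+\sum_{a=(u,v)\in A}y^t_a$ for all $v$, $t\in[T]$; (5) $x^{t-1}_u-x^{t-1}_v+\sum_{w\in N(u)\setminus\{v\}}x^{t-1}_w\le\sum_{a=(w,v)\in A}y^t_a+\deg(u)-1$ for all $(u,v)\in A$, $t\in[T]$; (6) $\frac1n\sum_{v}(x^t_v-x^{t-1}_v)-z^t\le0$ for all $t\in[T]$; (7) $z^t-\sum_{v}(x^t_v-x^{t-1}_v)\le0$ for all $t\in[T]$; (8) $\sum_{t\in[T]}z^t\ge k$. Then $C=\{v\in V: x^0_v=1\}$ is a minimum zero forcing set of $G$ such that $\operatorname{pt}(G,C)=\sum_{t\in[T]}z^t\ge k$. Furthermore, there is no minimum zero forcing set $\hat C$ such that $\operatorname{pt}(G,\hat C)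\in(k,\operatorname{pt}(G,C))$.
   Context: $[T]=\{1,\ldots,T\}$; $N(u)$ is the neighborhood, $\deg(u)=|N(u)|$; $A$ contains both arcs $(u,v),(v,u)$ for each edge. Standard zero forcing rule: a filled vertex $u$ forces a non-filled vertex $v$ if $v$ is the only non-filled neighbor of $u$. A zero forcing set is a set from which repeated forcing fills all vertices; a minimum one has cardinality $Z(G)$. $\operatorname{pt}(G,C)$ is the number of time steps needed to fill all vertices from $C$ when at each step all possible forces are applied simultaneously; $\operatorname{PT}(G)=\max\{\operatorname{pt}(G,C): C\text{ zero forcing set}, |C|=Z(G)\}$. -}

module Defs where

open import Data.Nat as ℕ using (ℕ; zero; suc)
open import Data.Integer as ℤ using (ℤ; +_; _+_; _-_; _*_)
open import Data.Fin using (Fin; zero; suc; inject₁)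
import Data.Fin as F
open import Data.Bool using (Bool; true; false; _∧_; _∨_; not; if_then_else_)
open import Data.Product using (Σ; _×_; _,_; ∃)
open import Data.Sum using (_⊎_)
open import Relation.Binary.PropositionalEquality using (_≡_; _≢_)
open import Relation.Nullary using (¬_; does)

record SimpleGraph (n : ℕ) : Set where
  field
    adj    : Fin n → Fin n → Bool
    sym    : ∀ u v → adj u v ≡ adj v u
    irrefl : ∀ v → adj v v ≡ false
open SimpleGraph public

∑ : ∀ {n} → (Fin n → ℤ) → ℤ
∑ {zero}  f = + 0
∑ {suc n} f = f zero + ∑ (λ i → f (suc i))

anyF : ∀ {n} → (Fin n → Bool) → Bool
anyF {zero}  f = false
anyF {suc n} f = f zero ∨ anyF (λ i → f (suc i))

allF : ∀ {n} → (Fin n → Bool) → Bool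
allF {zero}  f = true
allF {suc n} f = f zero ∧ allF (λ i → f (suc i))

count : ∀ {n} → (Fin n → Bool) → ℕ
count {zero}  f = 0
count {suc n} f = (if f zero then 1 else 0) ℕ.+ count (λ i → f (suc i))

[_] : Bool → ℤ
[ b ] = if b then + 1 else + 0

eqF : ∀ {n} → Fin n → Fin n → Bool
eqF u v = does (u F.≟ v)

deg : ∀ {n} → SimpleGraph n → Fin n → ℤ
deg G u = ∑ (λ w → [ adj G u w ])

forces : ∀ {n} → SimpleGraph n → (Fin n → Bool) → Fin n → Fin n → Bool
forces G S u v =
  S u ∧ adj G u v ∧ not (S v) ∧ allF (λ w → not (adj G u w) ∨ eqF w v ∨ S w)

step : ∀ {n} → SimpleGraph n → (Fin n → Bool) → (Fin n → Bool)
step G S v = S v ∨ anyF (λ u → forces G S u v)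

iter : ∀ {n} → SimpleGraph n → ℕ → (Fin n → Bool) → (Fin n → Bool)
iter G zero    S = S
iter G (suc k) S = step G (iter G k S)

AllFilled : ∀ {n} → (Fin n → Bool) → Set
AllFilled S = ∀ v → S v ≡ true

IsZFS : ∀ {n} → SimpleGraph n → (Fin n → Bool) → Set
IsZFS G C = ∃ λ k → AllFilled (iter G k C)

IsMinZFS : ∀ {n} → SimpleGraph n → (Fin n → Bool) → Set
IsMinZFS G C = IsZFS G C × (∀ C' → IsZFS G C' → count C ℕ.≤ count C')

PropTime : ∀ {n} → SimpleGraph n → (Fin n → Bool) → ℕ → Set
PropTime G C p = AllFilled (iter G p C) × (∀ q → q ℕ.< p → ¬ AllFilled (iter G q C))

IsPT : ∀ {n} → SimpleGraph n → ℕ → Set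
IsPT G P =
  (Σ (_ → Bool) λ C → IsMinZFS G C × PropTime G C P)
  × (∀ C q → IsMinZFS G C → PropTime G C q → q ℕ.≤ P)

-- The integer programming model (T given; times 0..T are Fin (suc T),
-- times in [T] are Fin T where index t stands for time t+1, so that
-- x^{t-1} = x (inject₁ t) and x^t = x (suc t)).
-- y t u v is the variable of arc (u,v); only arcs are ever used.

Binary : ℤ → Set
Binary b = b ≡ + 0 ⊎ b ≡ + 1

module Model {n : ℕ} (G : SimpleGraph n) (T : ℕ) (k : ℤ) where

  XVar = Fin (suc T) → Fin n → ℤ
  YVar = Fin T → Fin n → Fin n → ℤ
  ZVar = Fin T → ℤ

  inflow : YVar → Fin T → Fin n → ℤ
  inflow y t v = ∑ (λ u → [ adj G u v ] * y t u v)

  diff : XVar → Fin T → ℤ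
  diff x t = ∑ (λ v → x (suc t) v - x (inject₁ t) v)

  record Feasible (x : XVar) (y : YVar) (z : ZVar) : Set where
    field
      bx : ∀ t v → Binary (x t v)
      by : ∀ t u v → Binary (y t u v)
      bz : ∀ t → Binary (z t)
      c1 : ∀ v → x zero v + ∑ (λ t → inflow y t v) ≡ + 1
      c2 : ∀ u v t → adj G u v ≡ true → y t u v ℤ.≤ x (inject₁ t) u
      c3 : ∀ u v w t → adj G u v ≡ true → adj G u w ≡ true → w ≢ v →
           y t u v ℤ.≤ x (inject₁ t) w
      c4 : ∀ v t → x (suc t) v ≡ x (inject₁ t) v + inflow y t v
      c5 : ∀ u v t → adj G u v ≡ true →
           x (inject₁ t) u - x (inject₁ t) v
             + ∑ (λ w → [ adj G u w ∧ not (eqF w v) ] * x (inject₁ t) w)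
           ℤ.≤ inflow y t v + deg G u - + 1
      -- (6) multiplied by n > 0 : (1/n) diff - z ≤ 0  ⇔  diff - n z ≤ 0
      c6 : ∀ t → diff x t - + n * z t ℤ.≤ + 0
      c7 : ∀ t → z t - diff x t ℤ.≤ + 0
      c8 : k ℤ.≤ ∑ z

  -- objective sum_v x^0_v + (1/(2T)) sum_t z^t, multiplied by 2T
  objective : XVar → ZVar → ℤ
  objective x z = + (2 ℕ.* T) * ∑ (λ v → x zero v) + ∑ z

  Optimal : XVar → YVar → ZVar → Set
  Optimal x y z =
    Feasible x y z ×
    (∀ x' y' z' → Feasible x' y' z' → objective x z ℤ.≤ objective x' z')

initialSet : ∀ {n T} → (Fin (suc T) → Fin n → ℤ) → Fin n → Bool
initialSet x v = does (x zero v ℤ.≟ + 1)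

-- A feasible solution of the model is the trace of the zero forcing process
-- started from C = {v : x⁰_v = 1}: by (2)–(5) the set x^t arises from x^(t-1)
-- by one round of simultaneous forcing, y choosing one forcing neighbour for
-- each newly filled vertex; by (6)–(7) z^t records whether round t fills
-- anything, so ∑ z = pt(G,C); and (1) makes C a zero forcing set. Conversely
-- every zero forcing set C with k ≤ pt(G,C) yields such a solution. Scaled by
-- 2T the objective is 2T|C| + pt(G,C), and since pt(G,C) ≤ T an optimum first
-- minimises |C| (a minimum set attaining PT(G) ≥ k gives a feasible solution)
-- and then pt(G,C) among the minimum sets C with k ≤ pt(G,C).

module Submission where

open import Defs hiding (sym)
open import Data.Nat as ℕ using (ℕ; suc; zero; z≤n; s≤s; _<ᵇ_)
import Data.Nat.Properties as ℕₚ
open import Data.Integer as ℤ using (ℤ; +_; +≤+; _+_; _-_; _*_; _≤_; _<_)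
import Data.Integer.Properties as ℤₚ
open import Data.Fin as Fin using (Fin; zero; suc; inject₁; fromℕ; toℕ)
import Data.Fin.Properties as Finₚ
open import Data.Bool as Bool using (Bool; true; false; _∧_; _∨_; not)
open import Data.Bool.Properties using (∧-identityʳ; not-injective; T-≡)
open import Data.Empty using (⊥-elim)
open import Data.Product using (Σ; _×_; _,_; proj₁; proj₂; ∃)
open import Data.Sum using (inj₁; inj₂)
open import Function using (id; _∘_; _⇔_; mk⇔; Equivalence)
open import Function.Properties.Equivalence using () renaming (trans to ⇔-trans)
open import Relation.Binary.PropositionalEquality
  using (_≡_; _≢_; refl; sym; trans; cong; cong₂; subst; subst₂; module ≡-Reasoning)
open import Relation.Nullary using (¬_; Dec; yes; no; does)
open import Relation.Nullary.Decidable using (dec-true; dec-false)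
open import Relation.Nullary.Reflects using (ofʸ; ofⁿ)

∑-cong : ∀ {n} {f g : Fin n → ℤ} → (∀ i → f i ≡ g i) → ∑ f ≡ ∑ g
∑-cong {zero}  f≗g = refl
∑-cong {suc n} f≗g = cong₂ _+_ (f≗g zero) (∑-cong (f≗g ∘ suc))

∑-[]≡count : ∀ {n} (f : Fin n → Bool) → ∑ (λ i → [ f i ]) ≡ + count f
∑-[]≡count {zero}  f = refl
∑-[]≡count {suc n} f with f zero
... | true  = cong (_+_ (+ 1)) (∑-[]≡count (f ∘ suc))
... | false = trans (ℤₚ.+-identityˡ _) (∑-[]≡count (f ∘ suc))

[]*[]≡[∧] : ∀ a b → [ a ] * [ b ] ≡ [ a ∧ b ]
[]*[]≡[∧] true  true  = refl
[]*[]≡[∧] true  false = refl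
[]*[]≡[∧] false b     = refl

∑-[]*[]≡count-∧ : ∀ {n} (f g : Fin n → Bool) →
  ∑ (λ i → [ f i ] * [ g i ]) ≡ + count (λ i → f i ∧ g i)
∑-[]*[]≡count-∧ f g = trans (∑-cong (λ i → []*[]≡[∧] (f i) (g i))) (∑-[]≡count (λ i → f i ∧ g i))

∑-telescope : ∀ {T} (f : Fin (suc T) → ℤ) (g : Fin T → ℤ) →
  (∀ t → f (suc t) ≡ f (inject₁ t) + g t) → f (fromℕ T) ≡ f zero + ∑ g
∑-telescope {zero}  f g step = sym (ℤₚ.+-identityʳ (f zero))
∑-telescope {suc T} f g step = begin
  f (fromℕ (suc T))                         ≡⟨ ∑-telescope (f ∘ suc) (g ∘ suc) (step ∘ suc) ⟩
  f (suc zero) + ∑ (g ∘ suc)                 ≡⟨ cong (_+ ∑ (g ∘ suc)) (step zero) ⟩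
  f zero + g zero + ∑ (g ∘ suc)              ≡⟨ ℤₚ.+-assoc (f zero) (g zero) (∑ (g ∘ suc)) ⟩
  f zero + ∑ g                               ∎
  where open ≡-Reasoning

count≤n : ∀ {n} (f : Fin n → Bool) → count f ℕ.≤ n
count≤n {zero}  f = z≤n
count≤n {suc n} f with f zero
... | true  = s≤s (count≤n (f ∘ suc))
... | false = ℕₚ.m≤n⇒m≤1+n (count≤n (f ∘ suc))

all-false⇒count≡0 : ∀ {n} (f : Fin n → Bool) → (∀ i → f i ≡ false) → count f ≡ 0
all-false⇒count≡0 {zero}  f f≡false = refl
all-false⇒count≡0 {suc n} f f≡false rewrite f≡false zero = all-false⇒count≡0 (f ∘ suc) (f≡false ∘ suc)

count≡0⇒false : ∀ {n} (f : Fin n → Bool) → count f ≡ 0 → ∀ i → f i ≡ false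
count≡0⇒false {suc n} f c≡0 i with f zero in f₀
count≡0⇒false {suc n} f ()  i       | true
count≡0⇒false {suc n} f c≡0 zero    | false = f₀
count≡0⇒false {suc n} f c≡0 (suc i) | false = count≡0⇒false (f ∘ suc) c≡0 i

true⇒count>0 : ∀ {n} (f : Fin n → Bool) i → f i ≡ true → 1 ℕ.≤ count f
true⇒count>0 f zero    fi rewrite fi = s≤s z≤n
true⇒count>0 f (suc i) fi with f zero
... | true  = s≤s z≤n
... | false = true⇒count>0 (f ∘ suc) i fi

count-single : ∀ {n} (f : Fin n → Bool) v → f v ≡ true → (∀ w → f w ≡ true → w ≡ v) → count f ≡ 1
count-single f zero fv unique rewrite fv = cong suc (all-false⇒count≡0 (f ∘ suc) others)
  where
  others : ∀ i → f (suc i) ≡ false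
  others i with f (suc i) in fi
  ... | false = refl
  ... | true with unique (suc i) fi
  ... | ()
count-single f (suc v) fv unique with f zero in f₀
... | true with unique zero f₀
... | ()
count-single f (suc v) fv unique | false =
  count-single (f ∘ suc) v fv (λ w fw → Finₚ.suc-injective (unique (suc w) fw))

count-split : ∀ {n} (f g : Fin n → Bool) →
  count f ≡ count (λ i → f i ∧ g i) ℕ.+ count (λ i → f i ∧ not (g i))
count-split {zero}  f g = refl
count-split {suc n} f g with f zero | g zero
... | false | _     = count-split (f ∘ suc) (g ∘ suc)
... | true  | true  = cong suc (count-split (f ∘ suc) (g ∘ suc))
... | true  | false = trans (cong suc (count-split (f ∘ suc) (g ∘ suc))) (sym (ℕₚ.+-suc _ _))

count-mono : ∀ {n} (f g : Fin n → Bool) → (∀ i → f i ≡ true → g i ≡ true) → count f ℕ.≤ count g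
count-mono {zero}  f g f⊆g = z≤n
count-mono {suc n} f g f⊆g with f zero in f₀ | g zero in g₀
... | true  | true  = s≤s (count-mono (f ∘ suc) (g ∘ suc) (f⊆g ∘ suc))
... | true  | false with trans (sym (f⊆g zero f₀)) g₀
... | ()
count-mono {suc n} f g f⊆g | false | true  = ℕₚ.m≤n⇒m≤1+n (count-mono (f ∘ suc) (g ∘ suc) (f⊆g ∘ suc))
count-mono {suc n} f g f⊆g | false | false = count-mono (f ∘ suc) (g ∘ suc) (f⊆g ∘ suc)

count-mono-< : ∀ {n} (f g : Fin n → Bool) → (∀ i → f i ≡ true → g i ≡ true) →
  ∀ i → g i ≡ true → f i ≡ false → count f ℕ.< count g
count-mono-< f g f⊆g zero g₀ f₀ rewrite g₀ | f₀ = s≤s (count-mono (f ∘ suc) (g ∘ suc) (f⊆g ∘ suc))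
count-mono-< f g f⊆g (suc i) gi fi with f zero in f₀ | g zero in g₀
... | true  | true  = s≤s (count-mono-< (f ∘ suc) (g ∘ suc) (f⊆g ∘ suc) i gi fi)
... | true  | false with trans (sym (f⊆g zero f₀)) g₀
... | ()
count-mono-< f g f⊆g (suc i) gi fi | false | true  =
  ℕₚ.m≤n⇒m≤1+n (count-mono-< (f ∘ suc) (g ∘ suc) (f⊆g ∘ suc) i gi fi)
count-mono-< f g f⊆g (suc i) gi fi | false | false = count-mono-< (f ∘ suc) (g ∘ suc) (f⊆g ∘ suc) i gi fi

anyF-intro : ∀ {n} (f : Fin n → Bool) i → f i ≡ true → anyF f ≡ true
anyF-intro f zero    fi rewrite fi = refl
anyF-intro f (suc i) fi with f zero
... | true  = refl
... | false = anyF-intro (f ∘ suc) i fi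

anyF-witness : ∀ {n} (f : Fin n → Bool) → anyF f ≡ true → ∃ λ i → f i ≡ true
anyF-witness {suc n} f any with f zero in f₀
... | true  = zero , f₀
... | false with anyF-witness (f ∘ suc) any
... | i , fi = suc i , fi

anyF-false⇒false : ∀ {n} (f : Fin n → Bool) → anyF f ≡ false → ∀ i → f i ≡ false
anyF-false⇒false f none i with f i in fi
... | false = refl
... | true with trans (sym (anyF-intro f i fi)) none
... | ()

all-false⇒anyF-false : ∀ {n} (f : Fin n → Bool) → (∀ i → f i ≡ false) → anyF f ≡ false
all-false⇒anyF-false {zero}  f f≡false = refl
all-false⇒anyF-false {suc n} f f≡false rewrite f≡false zero = all-false⇒anyF-false (f ∘ suc) (f≡false ∘ suc)

anyF⇒count>0 : ∀ {n} (f : Fin n → Bool) → anyF f ≡ true → 1 ℕ.≤ count f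
anyF⇒count>0 f some = let i , fi = anyF-witness f some in true⇒count>0 f i fi

¬anyF⇒count≡0 : ∀ {n} (f : Fin n → Bool) → anyF f ≡ false → count f ≡ 0
¬anyF⇒count≡0 f none = all-false⇒count≡0 f (anyF-false⇒false f none)

∑-[<ᵇ]≡ : ∀ {T} q → q ℕ.≤ T → ∑ {T} (λ t → [ toℕ t <ᵇ q ]) ≡ + q
∑-[<ᵇ]≡ {T}     zero    z≤n       =
  trans (∑-[]≡count {T} (λ _ → false)) (cong +_ (all-false⇒count≡0 {T} _ (λ _ → refl)))
∑-[<ᵇ]≡ {suc T} (suc q) (s≤s q≤T) = cong (_+_ (+ 1)) (∑-[<ᵇ]≡ q q≤T)

anyF-cong : ∀ {n} {f g : Fin n → Bool} → (∀ i → f i ≡ g i) → anyF f ≡ anyF g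
anyF-cong {zero}  f≗g = refl
anyF-cong {suc n} f≗g = cong₂ _∨_ (f≗g zero) (anyF-cong (f≗g ∘ suc))

allF-elim : ∀ {n} (f : Fin n → Bool) → allF f ≡ true → ∀ i → f i ≡ true
allF-elim {suc n} f all i with f zero in f₀
allF-elim {suc n} f ()  i       | false
allF-elim {suc n} f all zero    | true = f₀
allF-elim {suc n} f all (suc i) | true = allF-elim (f ∘ suc) all i

allF-intro : ∀ {n} (f : Fin n → Bool) → (∀ i → f i ≡ true) → allF f ≡ true
allF-intro {zero}  f f≡true = refl
allF-intro {suc n} f f≡true rewrite f≡true zero = allF-intro (f ∘ suc) (f≡true ∘ suc)

allF-cong : ∀ {n} {f g : Fin n → Bool} → (∀ i → f i ≡ g i) → allF f ≡ allF g
allF-cong {zero}  f≗g = refl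
allF-cong {suc n} f≗g = cong₂ _∧_ (f≗g zero) (allF-cong (f≗g ∘ suc))

first : ∀ {n} → (Fin n → Bool) → Fin n → Bool
first f zero    = f zero
first f (suc i) = not (f zero) ∧ first (f ∘ suc) i

first⇒true : ∀ {n} (f : Fin n → Bool) i → first f i ≡ true → f i ≡ true
first⇒true f zero    fst = fst
first⇒true f (suc i) fst with f zero
... | false = first⇒true (f ∘ suc) i fst

+count-first≡[anyF] : ∀ {n} (f : Fin n → Bool) → + count (first f) ≡ [ anyF f ]
+count-first≡[anyF] {zero}  f = refl
+count-first≡[anyF] {suc n} f with f zero
... | true  = cong (λ c → + suc c) (all-false⇒count≡0 {n} (λ _ → false) (λ _ → refl))
... | false = +count-first≡[anyF] (f ∘ suc)

does≡true⇒ : ∀ {a} {A : Set a} (a? : Dec A) → does a? ≡ true → A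
does≡true⇒ (yes a) _ = a

does≡false⇒¬ : ∀ {a} {A : Set a} (a? : Dec A) → does a? ≡ false → ¬ A
does≡false⇒¬ (no ¬a) _ = ¬a

module _ {n} (G : SimpleGraph n) where

  record Forces (S : Fin n → Bool) (u v : Fin n) : Set where
    field
      filled        : S u ≡ true
      adjacent      : adj G u v ≡ true
      unfilled      : S v ≡ false
      others-filled : ∀ w → adj G u w ≡ true → w ≢ v → S w ≡ true

  open Forces public

  forces-sound : ∀ S u v → forces G S u v ≡ true → Forces S u v
  forces-sound S u v fs with S u in Su | adj G u v in uv | S v in Sv
  ... | true | true | false = record
    { filled = Su ; adjacent = uv ; unfilled = Sv ; others-filled = others }
    where
    others : ∀ w → adj G u w ≡ true → w ≢ v → S w ≡ true
    others w uw w≢v with allF-elim _ fs w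
    ... | ok rewrite uw | dec-false (w Fin.≟ v) w≢v = ok

  forces-complete : ∀ {S u v} → Forces S u v → forces G S u v ≡ true
  forces-complete {S} {u} {v} fo rewrite filled fo | adjacent fo | unfilled fo = allF-intro _ free
    where
    free : ∀ w → (not (adj G u w) ∨ eqF w v ∨ S w) ≡ true
    free w with adj G u w in uw | eqF w v in wv
    ... | false | _    = refl
    ... | true  | true = refl
    ... | true  | false rewrite others-filled fo w uw (does≡false⇒¬ (w Fin.≟ v) wv) = refl

  forces-cong : ∀ {S S′} → (∀ v → S v ≡ S′ v) → ∀ u v → forces G S u v ≡ forces G S′ u v
  forces-cong {S} {S′} S≗S′ u v rewrite S≗S′ u | S≗S′ v =
    cong (λ b → S′ u ∧ adj G u v ∧ not (S′ v) ∧ b)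
         (allF-cong (λ w → cong (λ b → not (adj G u w) ∨ eqF w v ∨ b) (S≗S′ w)))

  step-cong : ∀ {S S′} → (∀ v → S v ≡ S′ v) → ∀ v → step G S v ≡ step G S′ v
  step-cong S≗S′ v = cong₂ _∨_ (S≗S′ v) (anyF-cong (λ u → forces-cong S≗S′ u v))

  step-extensive : ∀ S v → S v ≡ true → step G S v ≡ true
  step-extensive S v Sv rewrite Sv = refl

  iter-extensive : ∀ C {i j} → i ℕ.≤ j → ∀ v → iter G i C v ≡ true → iter G j C v ≡ true
  iter-extensive C {i} i≤j v = go (ℕₚ.≤⇒≤′ i≤j)
    where
    go : ∀ {j} → i ℕ.≤′ j → iter G i C v ≡ true → iter G j C v ≡ true
    go ℕ.≤′-refl        = id
    go (ℕ.≤′-step {j} i≤′j) = step-extensive (iter G j C) v ∘ go i≤′j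

  filled-later : ∀ C {i j} → i ℕ.≤ j → AllFilled (iter G i C) → AllFilled (iter G j C)
  filled-later C i≤j full v = iter-extensive C i≤j v (full v)

  newly : (Fin n → Bool) → Fin n → Bool
  newly S v = step G S v ∧ not (S v)

  newly⇒ : ∀ S v → newly S v ≡ true → step G S v ≡ true × S v ≡ false
  newly⇒ S v nw with S v
  ... | false = trans (sym (∧-identityʳ _)) nw , refl

  full⇒no-newly : ∀ S → AllFilled S → ∀ v → newly S v ≡ false
  full⇒no-newly S full v rewrite full v = refl

  no-newly⇒step≗ : ∀ S → anyF (newly S) ≡ false → ∀ v → step G S v ≡ S v
  no-newly⇒step≗ S none v with S v | anyF-false⇒false (newly S) none v
  ... | true  | _ = refl
  ... | false | ¬new = trans (sym (∧-identityʳ _)) ¬new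

  stationary : ∀ C j → anyF (newly (iter G j C)) ≡ false → ∀ i v → iter G (i ℕ.+ j) C v ≡ iter G j C v
  stationary C j none zero    v = refl
  stationary C j none (suc i) v = trans (step-cong (stationary C j none i) v) (no-newly⇒step≗ (iter G j C) none v)

  anyF-newly≡<ᵇ : ∀ {C q} → PropTime G C q → ∀ j → anyF (newly (iter G j C)) ≡ (j <ᵇ q)
  anyF-newly≡<ᵇ {C} {q} (full , unfilled-before) j with j <ᵇ q | ℕₚ.<ᵇ-reflects-< j q
  ... | false | ofⁿ j≮q = all-false⇒anyF-false (newly (iter G j C))
                            (full⇒no-newly (iter G j C) (filled-later C (ℕₚ.≮⇒≥ j≮q) full))
  ... | true | ofʸ j<q with anyF (newly (iter G j C)) in new
  ...   | true  = refl
  ...   | false = ⊥-elim (unfilled-before j j<q λ v → trans (sym (stationary-until-q v)) (full v))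
    where
    stationary-until-q : ∀ v → iter G q C v ≡ iter G j C v
    stationary-until-q v = subst (λ i → iter G i C v ≡ iter G j C v) (ℕₚ.m∸n+n≡m (ℕₚ.<⇒≤ j<q))
                                 (stationary C j new (q ℕ.∸ j) v)

  ∑-newly≡propTime : ∀ {C q T} → PropTime G C q → q ℕ.≤ T →
    ∑ {T} (λ t → [ anyF (newly (iter G (toℕ t) C)) ]) ≡ + q
  ∑-newly≡propTime {q = q} {T} pt q≤T =
    trans (∑-cong {T} (λ t → cong [_] (anyF-newly≡<ᵇ pt (toℕ t)))) (∑-[<ᵇ]≡ q q≤T)

  count-step-grows : ∀ S → anyF (newly S) ≡ true → count S ℕ.< count (step G S)
  count-step-grows S some with anyF-witness (newly S) some
  ... | v , new = let stepped , unfilled-v = newly⇒ S v new in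
                  count-mono-< S (step G S) (step-extensive S) v stepped unfilled-v

  count+j≤count-iter : ∀ {C q} → PropTime G C q → ∀ j → j ℕ.≤ q →
    count C ℕ.+ j ℕ.≤ count (iter G j C)
  count+j≤count-iter {C} pt zero    _   = ℕₚ.≤-reflexive (ℕₚ.+-identityʳ (count C))
  count+j≤count-iter {C} pt (suc j) j<q = begin
    count C ℕ.+ suc j    ≡⟨ ℕₚ.+-suc (count C) j ⟩
    suc (count C ℕ.+ j)  ≤⟨ s≤s (count+j≤count-iter pt j (ℕₚ.<⇒≤ j<q)) ⟩
    suc (count S)        ≤⟨ count-step-grows S some-newly ⟩
    count (step G S)     ∎
    where
    open ℕₚ.≤-Reasoning
    S : Fin n → Bool
    S = iter G j C
    some-newly : anyF (newly S) ≡ true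
    some-newly = trans (anyF-newly≡<ᵇ pt j) (Equivalence.to T-≡ (ℕₚ.<⇒<ᵇ j<q))

  count+propTime≤n : ∀ {C q} → PropTime G C q → count C ℕ.+ q ℕ.≤ n
  count+propTime≤n {C} {q} pt = ℕₚ.≤-trans (count+j≤count-iter pt q ℕₚ.≤-refl) (count≤n (iter G q C))

  iter-empty : ∀ C → (∀ v → C v ≡ false) → ∀ j v → iter G j C v ≡ false
  iter-empty C empty zero    v = empty v
  iter-empty C empty (suc j) v = cong₂ _∨_ (iter-empty C empty j v) (all-false⇒anyF-false _ unforced)
    where
    unforced : ∀ u → forces G (iter G j C) u v ≡ false
    unforced u rewrite iter-empty C empty j u = refl

  zero-forcing-set-nonempty : ∀ {C} → IsZFS G C → Fin n → 1 ℕ.≤ count C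
  zero-forcing-set-nonempty {C} (j , full) v with count C in c≡0
  ... | suc _ = s≤s z≤n
  ... | zero with trans (sym (full v)) (iter-empty C (count≡0⇒false C c≡0) j v)
  ... | ()

  propTime-exists : ∀ C N → AllFilled (iter G N C) → Σ ℕ λ p → PropTime G C p × p ℕ.≤ N
  propTime-exists C zero    full = 0 , (full , λ _ ()) , z≤n
  propTime-exists C (suc N) full with Finₚ.all? (λ v → iter G N C v Bool.≟ true)
  ... | yes fullN = let p , pt , p≤N = propTime-exists C N fullN in p , pt , ℕₚ.m≤n⇒m≤1+n p≤N
  ... | no ¬fullN =
    suc N , (full , λ q q≤N fullq → ¬fullN (filled-later C (ℕₚ.≤-pred q≤N) fullq)) , ℕₚ.≤-refl

[]-binary : ∀ b → Binary [ b ]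
[]-binary true  = inj₂ refl
[]-binary false = inj₁ refl

isOne : ℤ → Bool
isOne a = does (a ℤ.≟ + 1)

binary≡[isOne] : ∀ {a} → Binary a → a ≡ [ isOne a ]
binary≡[isOne] (inj₁ refl) = refl
binary≡[isOne] (inj₂ refl) = refl

[]-mono : ∀ {a b} → (a ≡ true → b ≡ true) → [ a ] ≤ [ b ]
[]-mono {false} {false} a⇒b = ℤₚ.≤-refl
[]-mono {false} {true}  a⇒b = +≤+ z≤n
[]-mono {true}          a⇒b rewrite a⇒b refl = ℤₚ.≤-refl

+1≤[]⇒true : ∀ {b} → + 1 ≤ [ b ] → b ≡ true
+1≤[]⇒true {true}  _ = refl
+1≤[]⇒true {false} (+≤+ ())

[∨]≡[]+[] : ∀ a b → (a ≡ true → b ≡ false) → [ a ∨ b ] ≡ [ a ] + [ b ]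
[∨]≡[]+[] true  b a⇒¬b rewrite a⇒¬b refl = refl
[∨]≡[]+[] false b a⇒¬b = sym (ℤₚ.+-identityˡ [ b ])

[]-[]≡[∧not] : ∀ a b → (a ≡ true → b ≡ true) → [ b ] - [ a ] ≡ [ b ∧ not a ]
[]-[]≡[∧not] true  b a⇒b rewrite a⇒b refl = refl
[]-[]≡[∧not] false true  a⇒b = refl
[]-[]≡[∧not] false false a⇒b = refl

+m++[1+n]-1≡+[n+m] : ∀ m n → + m + + suc n - + 1 ≡ + (n ℕ.+ m)
+m++[1+n]-1≡+[n+m] m n rewrite ℕₚ.+-suc m n = cong +_ (ℕₚ.+-comm m n)

bit-inequality⇔ : ∀ su sv a m →
  ([ su ] - [ sv ] + + a ≤ + (a ℕ.+ m)) ⇔ (su ≡ true → sv ≡ false → 1 ℕ.≤ m)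
bit-inequality⇔ true  false a m = mk⇔
  (λ le _ _ → ℕₚ.+-cancelˡ-≤ a 1 m (subst (ℕ._≤ a ℕ.+ m) (ℕₚ.+-comm 1 a) (ℤₚ.drop‿+≤+ le)))
  (λ 1≤m → +≤+ (subst (ℕ._≤ a ℕ.+ m) (ℕₚ.+-comm a 1) (ℕₚ.+-monoʳ-≤ a (1≤m refl refl))))
bit-inequality⇔ true  true  a m = mk⇔ (λ _ _ ()) (λ _ → +≤+ (ℕₚ.m≤m+n a m))
bit-inequality⇔ false true  a m =
  mk⇔ (λ _ ()) (λ _ → ℤₚ.≤-trans (ℤₚ.m⊖n≤m a 1) (+≤+ (ℕₚ.m≤m+n a m)))
bit-inequality⇔ false false a m = mk⇔ (λ _ ()) (λ _ → +≤+ (ℕₚ.m≤m+n a m))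

indicator-bounds⇔ : ∀ {N} (f : Fin N → Bool) b →
  (+ count f - + N * [ b ] ≤ + 0 × [ b ] - + count f ≤ + 0) ⇔ b ≡ anyF f
indicator-bounds⇔ {N} f b with anyF f in any
indicator-bounds⇔ {N} f true  | true  = mk⇔ (λ _ → refl) λ _ →
  ℤₚ.i≤j⇒i-j≤0 (subst (+ count f ≤_) (sym (ℤₚ.*-identityʳ (+ N))) (+≤+ (count≤n f))) ,
  ℤₚ.i≤j⇒i-j≤0 (+≤+ (anyF⇒count>0 f any))
indicator-bounds⇔ {N} f true  | false = mk⇔ (λ (_ , upper) → ⊥-elim (ℕₚ.1+n≰n (1≤0 upper))) (λ ())
  where
  1≤0 : + 1 - + count f ≤ + 0 → 1 ℕ.≤ 0
  1≤0 upper = subst (1 ℕ.≤_) (¬anyF⇒count≡0 f any) (ℤₚ.drop‿+≤+ (ℤₚ.i-j≤0⇒i≤j upper))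
indicator-bounds⇔ {N} f false | true  =
  mk⇔ (λ (lower , _) → ⊥-elim (ℕₚ.1+n≰n (ℕₚ.≤-trans (anyF⇒count>0 f any) (count≤0 lower)))) (λ ())
  where
  count≤0 : + count f - + N * + 0 ≤ + 0 → count f ℕ.≤ 0
  count≤0 lower =
    ℤₚ.drop‿+≤+ (ℤₚ.i-j≤0⇒i≤j (subst (λ w → + count f - w ≤ + 0) (ℤₚ.*-zeroʳ (+ N)) lower))
indicator-bounds⇔ {N} f false | false = mk⇔ (λ _ → refl) λ _ →
  subst (λ c → + c - + N * + 0 ≤ + 0) (sym (¬anyF⇒count≡0 f any))
        (subst (λ w → + 0 - w ≤ + 0) (sym (ℤₚ.*-zeroʳ (+ N))) ℤₚ.≤-refl) ,
  ℤₚ.i≤j⇒i-j≤0 {j = + count f} (+≤+ z≤n)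

binary≡[∨] : ∀ {w s a I} → Binary w → w ≡ [ s ] + + I →
  (s ≡ false → a ≡ true → 1 ℕ.≤ I) → (s ≡ false → a ≡ false → I ≡ 0) → w ≡ [ s ∨ a ]
binary≡[∨] {s = true}          (inj₁ refl) ()   _      _
binary≡[∨] {s = true}          (inj₂ refl) _    _      _    = refl
binary≡[∨] {s = false} {true}  (inj₁ refl) refl forced _    = ⊥-elim (ℕₚ.1+n≰n (forced refl refl))
binary≡[∨] {s = false} {true}  (inj₂ refl) refl _      _    = refl
binary≡[∨] {s = false} {false} (inj₁ refl) refl _      _    = refl
binary≡[∨] {s = false} {false} (inj₂ refl) refl _      none with none refl refl
... | ()

module _ {n} (G : SimpleGraph n) (T : ℕ) (k : ℤ) where
  open Model G T k

  Encodes : XVar → (Fin n → Bool) → Set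
  Encodes x C = ∀ t v → x t v ≡ [ iter G (toℕ t) C v ]

  others : Fin n → Fin n → Fin n → Bool
  others u v w = adj G u w ∧ not (eqF w v)

  ForcingConstraint : XVar → YVar → Fin n → Fin n → Fin T → Set
  ForcingConstraint x y u v t =
    x (inject₁ t) u - x (inject₁ t) v + ∑ (λ w → [ others u v w ] * x (inject₁ t) w)
      ≤ inflow y t v + deg G u - + 1

  deg-split : ∀ (S : Fin n → Bool) {u v} → adj G u v ≡ true →
    deg G u ≡ + suc (count (λ w → others u v w ∧ S w) ℕ.+ count (λ w → others u v w ∧ not (S w)))
  deg-split S {u} {v} uv = trans (∑-[]≡count (adj G u)) (cong +_ (begin
    count (adj G u)
      ≡⟨ count-split (adj G u) (λ w → eqF w v) ⟩
    count (λ w → adj G u w ∧ eqF w v) ℕ.+ count (others u v)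
      ≡⟨ cong₂ ℕ._+_ only-v (count-split (others u v) S) ⟩
    suc (count (λ w → others u v w ∧ S w) ℕ.+ count (λ w → others u v w ∧ not (S w)))
      ∎))
    where
    open ≡-Reasoning
    only-v : count (λ w → adj G u w ∧ eqF w v) ≡ 1
    only-v = count-single _ v (cong₂ _∧_ uv (dec-true (v Fin.≟ v) refl)) unique
      where
      unique : ∀ w → (adj G u w ∧ eqF w v) ≡ true → w ≡ v
      unique w uw∧w≡v with adj G u w
      ... | true = does≡true⇒ (w Fin.≟ v) uw∧w≡v

  others-filled⇔ : ∀ (S : Fin n → Bool) u v →
    (∀ w → adj G u w ≡ true → w ≢ v → S w ≡ true) ⇔ (count (λ w → others u v w ∧ not (S w)) ≡ 0)
  others-filled⇔ S u v = mk⇔ (λ all-filled → all-false⇒count≡0 _ (to all-filled)) from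
    where
    to : (∀ w → adj G u w ≡ true → w ≢ v → S w ≡ true) → ∀ w → (others u v w ∧ not (S w)) ≡ false
    to all-filled w with adj G u w in uw | eqF w v in wv
    ... | false | _     = refl
    ... | true  | true  = refl
    ... | true  | false rewrite all-filled w uw (does≡false⇒¬ (w Fin.≟ v) wv) = refl
    from : count (λ w → others u v w ∧ not (S w)) ≡ 0 → ∀ w → adj G u w ≡ true → w ≢ v → S w ≡ true
    from r≡0 w uw w≢v with count≡0⇒false (λ w → others u v w ∧ not (S w)) r≡0 w
    ... | unfilled-other rewrite uw | dec-false (w Fin.≟ v) w≢v = not-injective unfilled-other

  forcing-constraint⇔ : ∀ {x y S u v t i} → (∀ w → x (inject₁ t) w ≡ [ S w ]) → adj G u v ≡ true →
    inflow y t v ≡ + i → ForcingConstraint x y u v t ⇔ (Forces G S u v → 1 ℕ.≤ i)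
  forcing-constraint⇔ {x} {y} {S} {u} {v} {t} {i} x≗S uv inflow≡i =
    ⇔-trans (mk⇔ (subst₂ _≤_ lhs≡ rhs≡) (subst₂ _≤_ (sym lhs≡) (sym rhs≡)))
            (⇔-trans (bit-inequality⇔ (S u) (S v) a (r ℕ.+ i)) (mk⇔ to from))
    where
    a r : ℕ
    a = count (λ w → others u v w ∧ S w)
    r = count (λ w → others u v w ∧ not (S w))
    lhs≡ : x (inject₁ t) u - x (inject₁ t) v + ∑ (λ w → [ others u v w ] * x (inject₁ t) w)
           ≡ [ S u ] - [ S v ] + + a
    lhs≡ = cong₂ _+_ (cong₂ _-_ (x≗S u) (x≗S v))
                     (trans (∑-cong (λ w → cong ([ others u v w ] *_) (x≗S w))) (∑-[]*[]≡count-∧ (others u v) S))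
    rhs≡ : inflow y t v + deg G u - + 1 ≡ + (a ℕ.+ (r ℕ.+ i))
    rhs≡ = begin
      inflow y t v + deg G u - + 1   ≡⟨ cong₂ (λ ι d → ι + d - + 1) inflow≡i (deg-split S uv) ⟩
      + i + + suc (a ℕ.+ r) - + 1    ≡⟨ +m++[1+n]-1≡+[n+m] i (a ℕ.+ r) ⟩
      + (a ℕ.+ r ℕ.+ i)              ≡⟨ cong +_ (ℕₚ.+-assoc a r i) ⟩
      + (a ℕ.+ (r ℕ.+ i))            ∎
      where open ≡-Reasoning
    to : (S u ≡ true → S v ≡ false → 1 ℕ.≤ r ℕ.+ i) → Forces G S u v → 1 ℕ.≤ i
    to forced fo = subst (λ r → 1 ℕ.≤ r ℕ.+ i) (Equivalence.to (others-filled⇔ S u v) (others-filled fo))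
                         (forced (filled fo) (unfilled fo))
    from : (Forces G S u v → 1 ℕ.≤ i) → S u ≡ true → S v ≡ false → 1 ℕ.≤ r ℕ.+ i
    from forced Su Sv with r in r≡
    ... | zero  = forced (record { filled = Su ; adjacent = uv ; unfilled = Sv
                                 ; others-filled = Equivalence.from (others-filled⇔ S u v) r≡ })
    ... | suc _ = s≤s z≤n

  module _ {x C} (x-encodes : Encodes x C) where

    encodes-before : ∀ t v → x (inject₁ t) v ≡ [ iter G (toℕ t) C v ]
    encodes-before t v =
      trans (x-encodes (inject₁ t) v) (cong (λ j → [ iter G j C v ]) (Finₚ.toℕ-inject₁ t))

    diff≡count-newly : ∀ t → diff x t ≡ + count (newly G (iter G (toℕ t) C))
    diff≡count-newly t = trans (∑-cong new) (∑-[]≡count (newly G S))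
      where
      S : Fin n → Bool
      S = iter G (toℕ t) C
      new : ∀ v → x (suc t) v - x (inject₁ t) v ≡ [ newly G S v ]
      new v = trans (cong₂ _-_ (x-encodes (suc t) v) (encodes-before t v))
                    ([]-[]≡[∧not] (S v) (step G S v) (step-extensive G S v))

    objective≡ : ∀ {z p} → ∑ z ≡ + p → objective x z ≡ + (2 ℕ.* T ℕ.* count C ℕ.+ p)
    objective≡ {z} {p} ∑z≡p = begin
      + (2 ℕ.* T) * ∑ (λ v → x zero v) + ∑ z   ≡⟨ cong₂ (λ c s → + (2 ℕ.* T) * c + s) ∑x₀≡ ∑z≡p ⟩
      + (2 ℕ.* T) * + count C + + p          ≡⟨ cong (_+ + p) (sym (ℤₚ.pos-* (2 ℕ.* T) (count C))) ⟩
      + (2 ℕ.* T ℕ.* count C ℕ.+ p)          ∎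
      where
      open ≡-Reasoning
      ∑x₀≡ : ∑ (λ v → x zero v) ≡ + count C
      ∑x₀≡ = trans (∑-cong (x-encodes zero)) (∑-[]≡count C)

  module Encoding {C q} (pt : PropTime G C q) (q≤T : q ℕ.≤ T) (k≤q : k ≤ + q) where

    state : Fin T → Fin n → Bool
    state t = iter G (toℕ t) C

    forcers : Fin T → Fin n → Fin n → Bool
    forcers t v u = forces G (state t) u v

    x : XVar
    x t v = [ iter G (toℕ t) C v ]

    -- v may have several forcing neighbours; recording only the first makes v
    -- receive exactly one force, as (1) and (4) demand.
    y : YVar
    y t u v = [ first (forcers t v) u ]

    z : ZVar
    z t = [ anyF (newly G (state t)) ]

    x-encodes : Encodes x C
    x-encodes t v = refl

    first-forcer : ∀ t u v → first (forcers t v) u ≡ true → Forces G (state t) u v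
    first-forcer t u v fst = forces-sound G (state t) u v (first⇒true (forcers t v) u fst)

    inflow≡ : ∀ t v → inflow y t v ≡ + count (first (forcers t v))
    inflow≡ t v = trans (∑-cong only-first) (∑-[]≡count (first (forcers t v)))
      where
      only-first : ∀ u → [ adj G u v ] * y t u v ≡ [ first (forcers t v) u ]
      only-first u with first (forcers t v) u in fst
      ... | true  = cong (_* + 1) (cong [_] (adjacent (first-forcer t u v fst)))
      ... | false = ℤₚ.*-zeroʳ [ adj G u v ]

    step-encoded : ∀ v t → x (suc t) v ≡ x (inject₁ t) v + inflow y t v
    step-encoded v t = begin
      [ state t v ∨ anyF (forcers t v) ]      ≡⟨ [∨]≡[]+[] (state t v) _ filled⇒unforced ⟩
      [ state t v ] + [ anyF (forcers t v) ]  ≡⟨ cong₂ _+_ (sym (encodes-before x-encodes t v)) (sym inflow≡[anyF]) ⟩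
      x (inject₁ t) v + inflow y t v          ∎
      where
      open ≡-Reasoning
      inflow≡[anyF] : inflow y t v ≡ [ anyF (forcers t v) ]
      inflow≡[anyF] = trans (inflow≡ t v) (+count-first≡[anyF] (forcers t v))
      filled⇒unforced : state t v ≡ true → anyF (forcers t v) ≡ false
      filled⇒unforced filled-v = all-false⇒anyF-false (forcers t v) unforced
        where
        unforced : ∀ u → forces G (state t) u v ≡ false
        unforced u with forces G (state t) u v in fs
        ... | false = refl
        ... | true with trans (sym filled-v) (unfilled (forces-sound G (state t) u v fs))
        ... | ()

    ∑z≡q : ∑ z ≡ + q
    ∑z≡q = ∑-newly≡propTime G pt q≤T

    forced⇒received : ∀ t u v → Forces G (state t) u v → 1 ℕ.≤ count (first (forcers t v))
    forced⇒received t u v fo = ℕₚ.≤-reflexive (sym (ℤₚ.+-injective (begin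
      + count (first (forcers t v))  ≡⟨ +count-first≡[anyF] (forcers t v) ⟩
      [ anyF (forcers t v) ]         ≡⟨ cong [_] (anyF-intro (forcers t v) u (forces-complete G fo)) ⟩
      + 1                            ∎)))
      where open ≡-Reasoning

    feasible : Feasible x y z
    feasible = record
      { bx = λ t v → []-binary _
      ; by = λ t u v → []-binary _
      ; bz = λ t → []-binary _
      ; c1 = λ v → trans (sym (∑-telescope (λ t → x t v) (λ t → inflow y t v) (step-encoded v)))
                         (finally-filled v)
      ; c2 = λ u v t _ → subst (y t u v ≤_) (sym (encodes-before x-encodes t u))
                               ([]-mono (filled ∘ first-forcer t u v))
      ; c3 = λ u v w t _ uw w≢v → subst (y t u v ≤_) (sym (encodes-before x-encodes t w))
                                        ([]-mono (λ fst → others-filled (first-forcer t u v fst) w uw w≢v))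
      ; c4 = step-encoded
      ; c5 = λ u v t uv → Equivalence.from
                              (forcing-constraint⇔ {x} {y} {t = t} (encodes-before x-encodes t) uv (inflow≡ t v))
                              (forced⇒received t u v)
      ; c6 = λ t → proj₁ (bounds t)
      ; c7 = λ t → proj₂ (bounds t)
      ; c8 = subst (k ≤_) (sym ∑z≡q) k≤q
      }
      where
      finally-filled : ∀ v → x (fromℕ T) v ≡ + 1
      finally-filled v = cong [_] (subst (λ j → iter G j C v ≡ true) (sym (Finₚ.toℕ-fromℕ T))
                                         (filled-later G C q≤T (proj₁ pt) v))
      bounds : ∀ t → diff x t - + n * z t ≤ + 0 × z t - diff x t ≤ + 0
      bounds t rewrite diff≡count-newly x-encodes t = Equivalence.from (indicator-bounds⇔ (newly G (state t)) _) refl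

    objective-encoded : objective x z ≡ + (2 ℕ.* T ℕ.* count C ℕ.+ q)
    objective-encoded = objective≡ x-encodes ∑z≡q

  optimal-objective≤ : ∀ {x y z C q} → Optimal x y z → PropTime G C q → q ℕ.≤ T → k ≤ + q →
    objective x z ≤ + (2 ℕ.* T ℕ.* count C ℕ.+ q)
  optimal-objective≤ (_ , optimal) pt q≤T k≤q =
    subst (_ ≤_) objective-encoded (optimal x y z feasible)
    where open Encoding pt q≤T k≤q

  module Decoding {x y z} (feasible : Feasible x y z) where
    open Feasible feasible

    C : Fin n → Bool
    C = initialSet x

    received : Fin T → Fin n → Fin n → Bool
    received t v u = adj G u v ∧ isOne (y t u v)

    inflow≡ : ∀ t v → inflow y t v ≡ + count (received t v)
    inflow≡ t v = trans (∑-cong bit) (∑-[]≡count (received t v))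
      where
      bit : ∀ u → [ adj G u v ] * y t u v ≡ [ received t v u ]
      bit u = trans (cong ([ adj G u v ] *_) (binary≡[isOne] (by t u v)))
                    ([]*[]≡[∧] (adj G u v) (isOne (y t u v)))

    received⇒forced : ∀ {S} t u v → (∀ w → x (inject₁ t) w ≡ [ S w ]) →
      received t v u ≡ true → S v ≡ false → Forces G S u v
    received⇒forced t u v x≗S rec Sv with adj G u v in uv | y t u v ℤ.≟ + 1
    received⇒forced t u v x≗S () Sv | false | _
    received⇒forced t u v x≗S () Sv | true  | no _
    received⇒forced t u v x≗S rec Sv | true | yes y≡1 = record
      { filled        = +1≤[]⇒true (subst₂ _≤_ y≡1 (x≗S u) (c2 u v t uv))
      ; adjacent      = uv
      ; unfilled      = Sv
      ; others-filled = λ w uw w≢v → +1≤[]⇒true (subst₂ _≤_ y≡1 (x≗S w) (c3 u v w t uv uw w≢v))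
      }

    step-decoded : ∀ {S} t → (∀ w → x (inject₁ t) w ≡ [ S w ]) → ∀ v → x (suc t) v ≡ [ step G S v ]
    step-decoded {S} t x≗S v = binary≡[∨] (bx (suc t) v) x′≡ forced⇒received unforced⇒none
      where
      x′≡ : x (suc t) v ≡ [ S v ] + + count (received t v)
      x′≡ = trans (c4 v t) (cong₂ _+_ (x≗S v) (inflow≡ t v))
      forced⇒received : S v ≡ false → anyF (λ u → forces G S u v) ≡ true → 1 ℕ.≤ count (received t v)
      forced⇒received _ some with anyF-witness (λ u → forces G S u v) some
      ... | u , fs = Equivalence.to (forcing-constraint⇔ {x} {y} {t = t} x≗S (adjacent fo) (inflow≡ t v))
                                    (c5 u v t (adjacent fo)) fo
        where
        fo : Forces G S u v
        fo = forces-sound G S u v fs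
      unforced⇒none : S v ≡ false → anyF (λ u → forces G S u v) ≡ false → count (received t v) ≡ 0
      unforced⇒none Sv none = all-false⇒count≡0 (received t v) not-received
        where
        not-received : ∀ u → received t v u ≡ false
        not-received u with received t v u in rec
        ... | false = refl
        ... | true with trans (sym (forces-complete G (received⇒forced t u v x≗S rec Sv)))
                              (anyF-false⇒false (λ u → forces G S u v) none u)
        ...   | ()

    x-encodes : Encodes x C
    x-encodes t = encodes-at (toℕ t) t refl
      where
      encodes-at : ∀ j t → toℕ t ≡ j → ∀ v → x t v ≡ [ iter G j C v ]
      encodes-at zero    zero    _  v = binary≡[isOne] (bx zero v)
      encodes-at (suc j) (suc t) tj =
        step-decoded t (encodes-at j (inject₁ t) (trans (Finₚ.toℕ-inject₁ t) (ℕₚ.suc-injective tj)))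
      encodes-at zero    (suc t) ()
      encodes-at (suc j) zero    ()

    finally-filled : AllFilled (iter G T C)
    finally-filled v = +1≤[]⇒true (ℤₚ.≤-reflexive (begin
      + 1                                      ≡⟨ sym (c1 v) ⟩
      x zero v + ∑ (λ t → inflow y t v)        ≡⟨ sym (∑-telescope (λ t → x t v) (λ t → inflow y t v) (c4 v)) ⟩
      x (fromℕ T) v                            ≡⟨ x-encodes (fromℕ T) v ⟩
      [ iter G (toℕ (fromℕ T)) C v ]           ≡⟨ cong (λ j → [ iter G j C v ]) (Finₚ.toℕ-fromℕ T) ⟩
      [ iter G T C v ]                         ∎))
      where open ≡-Reasoning

    z≡ : ∀ t → z t ≡ [ anyF (newly G (iter G (toℕ t) C)) ]
    z≡ t = trans (binary≡[isOne] (bz t))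
                 (cong [_] (Equivalence.to (indicator-bounds⇔ (newly G S) (isOne (z t))) bounds))
      where
      S : Fin n → Bool
      S = iter G (toℕ t) C
      bounds : + count (newly G S) - + n * [ isOne (z t) ] ≤ + 0
             × [ isOne (z t) ] - + count (newly G S) ≤ + 0
      bounds rewrite sym (diff≡count-newly x-encodes t) | sym (binary≡[isOne] (bz t)) = c6 t , c7 t

    is-zfs : IsZFS G C
    is-zfs = T , finally-filled

    propagation : Σ ℕ λ p → PropTime G C p × p ℕ.≤ T
    propagation = propTime-exists G C T finally-filled

    p : ℕ
    p = proj₁ propagation

    time : PropTime G C p
    time = proj₁ (proj₂ propagation)

    p≤T : p ℕ.≤ T
    p≤T = proj₂ (proj₂ propagation)

    ∑z≡p : ∑ z ≡ + p
    ∑z≡p = trans (∑-cong z≡) (∑-newly≡propTime G time p≤T)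

    objective-decoded : objective x z ≡ + (2 ℕ.* T ℕ.* count C ℕ.+ p)
    objective-decoded = objective≡ x-encodes ∑z≡p

m*c≤m*c′+r⇒c≤c′ : ∀ m {c c′ r} → r ℕ.< m → m ℕ.* c ℕ.≤ m ℕ.* c′ ℕ.+ r → c ℕ.≤ c′
m*c≤m*c′+r⇒c≤c′ m {c} {c′} {r} r<m le = ℕₚ.≤-pred (ℕₚ.*-cancelˡ-< m c (suc c′) (begin-strict
  m ℕ.* c          ≤⟨ le ⟩
  m ℕ.* c′ ℕ.+ r   <⟨ ℕₚ.+-monoʳ-< (m ℕ.* c′) r<m ⟩
  m ℕ.* c′ ℕ.+ m   ≡⟨ ℕₚ.+-comm (m ℕ.* c′) m ⟩
  m ℕ.+ m ℕ.* c′   ≡⟨ sym (ℕₚ.*-suc m c′) ⟩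
  m ℕ.* suc c′     ∎))
  where open ℕₚ.≤-Reasoning

weighted-count≤⇒count≤ : ∀ {m c c′ p P} → P ℕ.≤ m → 2 ℕ.* m ℕ.* c ℕ.+ p ℕ.≤ 2 ℕ.* m ℕ.* c′ ℕ.+ P →
  c ℕ.≤ suc m → 1 ℕ.≤ c′ → c ℕ.≤ c′
weighted-count≤⇒count≤ {zero}              _   _  c≤1 1≤c′ = ℕₚ.≤-trans c≤1 1≤c′
weighted-count≤⇒count≤ {suc m} {c} {_} {p} P≤m le _   _    =
  m*c≤m*c′+r⇒c≤c′ (2 ℕ.* suc m) (ℕₚ.≤-<-trans P≤m (ℕₚ.m<m+n (suc m) (s≤s z≤n)))
                  (ℕₚ.≤-trans (ℕₚ.m≤m+n (2 ℕ.* suc m ℕ.* c) p) le)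

corollary4p8 : ∀ {m : ℕ} (G : SimpleGraph (suc m)) (k : ℤ) (P : ℕ) →
  IsPT G P → k ℤ.≤ + P →
  (x : Fin (suc m) → Fin (suc m) → ℤ) (y : Fin m → Fin (suc m) → Fin (suc m) → ℤ) (z : Fin m → ℤ) →
  Model.Optimal G m k x y z →
  IsMinZFS G (initialSet x)
  × Σ ℕ (λ p → PropTime G (initialSet x) p × ∑ z ≡ + p × k ℤ.≤ + p
    × (∀ (Ĉ : Fin (suc m) → Bool) (q : ℕ) → IsMinZFS G Ĉ → PropTime G Ĉ q →
        ¬ (k ℤ.< + q × q ℕ.< p)))
corollary4p8 {m} G k P ((C* , C*-minimal , C*-time) , _) k≤P x y z optimal =
  (is-zfs , minimal) , p , time , ∑z≡p , k≤p , no-intermediate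
  where
  open Decoding G m k (proj₁ optimal)

  cost≤ : ∀ {Ĉ q} → PropTime G Ĉ q → q ℕ.≤ m → k ≤ + q →
    2 ℕ.* m ℕ.* count C ℕ.+ p ℕ.≤ 2 ℕ.* m ℕ.* count Ĉ ℕ.+ q
  cost≤ Ĉ-time q≤m k≤q =
    ℤₚ.drop‿+≤+ (subst (_≤ _) objective-decoded (optimal-objective≤ G m k optimal Ĉ-time q≤m k≤q))

  C*-nonempty : 1 ℕ.≤ count C*
  C*-nonempty = zero-forcing-set-nonempty G (proj₁ C*-minimal) zero

  P≤m : P ℕ.≤ m
  P≤m = ℕₚ.≤-pred (ℕₚ.≤-trans (ℕₚ.+-monoˡ-≤ P C*-nonempty) (count+propTime≤n G C*-time))

  minimal : ∀ C′ → IsZFS G C′ → count C ℕ.≤ count C′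
  minimal C′ C′-zfs = ℕₚ.≤-trans (weighted-count≤⇒count≤ P≤m (cost≤ C*-time P≤m k≤P) (count≤n C) C*-nonempty)
                                 (proj₂ C*-minimal C′ C′-zfs)

  k≤p : k ≤ + p
  k≤p = subst (k ≤_) ∑z≡p (Model.Feasible.c8 (proj₁ optimal))

  no-intermediate : ∀ Ĉ q → IsMinZFS G Ĉ → PropTime G Ĉ q → ¬ (k < + q × q ℕ.< p)
  no-intermediate Ĉ q (Ĉ-zfs , Ĉ-minimal) Ĉ-time (k<q , q<p) =
    ℕₚ.<⇒≱ q<p (ℕₚ.+-cancelˡ-≤ (2 ℕ.* m ℕ.* count C) p q
      (subst (λ c → 2 ℕ.* m ℕ.* count C ℕ.+ p ℕ.≤ 2 ℕ.* m ℕ.* c ℕ.+ q) same-size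
             (cost≤ Ĉ-time (ℕₚ.≤-trans (ℕₚ.<⇒≤ q<p) p≤T) (ℤₚ.<⇒≤ k<q))))
    where
    same-size : count Ĉ ≡ count C
    same-size = ℕₚ.≤-antisym (Ĉ-minimal C is-zfs) (minimal Ĉ Ĉ-zfs)
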